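{- Let $G$ be a limit graph with infinite diameter. Then every vertex of $G$ has infinite degree.
   Context: Game of cops and robbers: on a connected graph $G$, the cop picks a start vertex, then the robber; they then alternately move (cop first) to an adjacent vertex or stay put; the cop wins if he lands on the robber's vertex; $G$ is cop-win if the cop has a winning strategy. Ordinal capture times: let $G$ have cardinality $\aleph_\beta$, let $\omega(G)=\omega_{\beta+1}$, and let $N[v]$ be the closed neighborhood of $v$. Define relations $\le_\alpha$ ($\alpha<\omega(G)$) on $V(G)$ by: $u\le_0 v$ iff $u=v$; and $u\le_\alpha v$ iff for every $x\in N[u]$ there is $y\in N[v]$ and $\gamma<\alpha$ with $x\le_\gamma y$. Let $\eta(u,v)$ be the least ordinal $\alpha$ with $u\le_\alpha v$ (for finite values this is the time for a cop at $v$ to catch a robber at $u$ with the robber moving first, under optimal play). Let $\eta(v)$ be the least $\alpha$ with $u\le_\alpha v$ for all $u$, and $\rho(G)=\sup_{v}\eta(v)$. A limit graph is a cop-win graph $G$ with $\rho(G)=\omega$ such that $\eta(u,v)\neq\omega$ for all vertices $u,v$. -}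

module Defs where

open import Data.Nat using (ℕ; zero; suc; _≤_)
open import Data.Fin using (Fin)
open import Data.List using (List; []; _∷_)
open import Data.Product using (Σ; _×_; ∃; ∃-syntax)
open import Data.Sum using (_⊎_)
open import Data.Empty using (⊥)
open import Relation.Nullary using (¬_)
open import Relation.Binary.PropositionalEquality using (_≡_)

module _ {V : Set} (E : V → V → Set) where

  IsSimple : Set
  IsSimple = (∀ u v → E u v → E v u) × (∀ v → ¬ E v v)

  N[_] : V → V → Set
  N[ v ] x = (x ≡ v) ⊎ E v x

  -- Reach n u v : there is a walk of length ≤ n from u to v,
  -- i.e. dist(u,v) ≤ n
  Reach : ℕ → V → V → Set
  Reach zero u v = u ≡ v
  Reach (suc n) u v = Σ V λ w → N[ u ] w × Reach n w v

  Connected : Set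
  Connected = ∀ u v → ∃[ n ] Reach n u v

  InfiniteDiameter : Set
  InfiniteDiameter = ∀ n → Σ V λ u → Σ V λ v → ¬ Reach n u v

  -- A cop strategy maps the history of robber positions (most recent
  -- first) to the cop's next position; s [] is the cop's start vertex.

  hist : (ℕ → V) → ℕ → List V
  hist r zero = r zero ∷ []
  hist r (suc k) = r (suc k) ∷ hist r k

  copPos : (List V → V) → (ℕ → V) → ℕ → V
  copPos s r zero = s []
  copPos s r (suc k) = s (hist r k)

  RobberPlay : (ℕ → V) → Set
  RobberPlay r = ∀ k → N[ r k ] (r (suc k))

  -- order of moves: c0, r0, c1, r1, c2, ...  (cop moves first after
  -- the placement).  Capture: robber placed/moved onto the cop
  -- (c k ≡ r k) or cop lands on the robber (c (k+1) ≡ r k).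
  WinningCopStrategy : (List V → V) → Set
  WinningCopStrategy s = ∀ r → RobberPlay r →
    (∀ k → N[ copPos s r k ] (copPos s r (suc k)))
    × (∃[ k ] (copPos s r k ≡ r k ⊎ copPos s r (suc k) ≡ r k))

  CopWin : Set
  CopWin = Σ (List V → V) WinningCopStrategy

  -- The relations ≤_α for α ≤ ω (only these stages are needed to
  -- express ρ(G) = ω and η(u,v) ≠ ω).
  -- le n u v  is  u ≤_n v ;  atMost n x y  is  ∃ γ ≤ n, x ≤_γ y.

  mutual
    le : ℕ → V → V → Set
    le zero u v = u ≡ v
    le (suc n) u v = ∀ x → N[ u ] x → Σ V λ y → N[ v ] y × atMost n x y

    atMost : ℕ → V → V → Set
    atMost zero x y = le zero x y
    atMost (suc n) x y = le (suc n) x y ⊎ atMost n x y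

  leω : V → V → Set
  leω u v = ∀ x → N[ u ] x → Σ V λ y → N[ v ] y × ∃[ n ] le n x y

  ηPair≡ω : V → V → Set
  ηPair≡ω u v = leω u v × (∀ n → ¬ le n u v)

  ηVertex≤ω : V → Set
  ηVertex≤ω v = (∃[ n ] (∀ u → le n u v)) ⊎ (∀ u → leω u v)

  ηVertex>_ : ℕ → V → Set
  ηVertex>_ n v = ∀ m → m ≤ n → ¬ (∀ u → le m u v)

  -- ρ(G) = sup_v η(v) = ω
  ρ≡ω : Set
  ρ≡ω = (∀ v → ηVertex≤ω v) × (∀ n → Σ V λ v → ηVertex>_ n v)

  LimitGraph : Set
  LimitGraph = CopWin × ρ≡ω × (∀ u v → ¬ ηPair≡ω u v)

-- Finite / infinite types (Kuratowski-style: finite = image of some Fin n)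

Finite : Set → Set
Finite A = ∃[ n ] Σ (Fin n → A) λ f → ∀ a → ∃[ i ] f i ≡ a

Infinite : Set → Set
Infinite A = ¬ Finite A

{-# OPTIONS --safe #-}
-- In a limit graph η(v) ≤ ω and η(u,v) ≠ ω, so every η(u,v) is finite. If v had finitely
-- many neighbours, η(y,v) would be bounded by one n for all neighbours y. But by infinite
-- diameter some z lies farther than n from v, and a robber placed on the second vertex y of a
-- shortest path from v to z can run along that path, staying out of reach of a cop starting
-- at v for n rounds; hence η(y,v) > n. Reachability is undecidable, so the argument runs
-- under double negation.
module Submission where

open import Defs
open import Data.Product using (Σ; _×_; _,_; proj₁; ∃-syntax)
open import Data.Nat using (ℕ; zero; suc; _+_; _⊔_; _≤_; _≤′_; ≤′-refl; ≤′-step; z≤n; s≤s; _≤?_)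
open import Data.Nat.Properties
  using (≤-refl; ≤-trans; m≤n⇒m≤1+n; m≤m⊔n; m≤n⊔m; ≤⇒≤′; ≰⇒>; +-identityʳ; +-suc)
open import Data.Fin using (Fin; zero; suc)
open import Data.Sum using (inj₁; inj₂)
open import Effect.Monad using (RawMonad)
open import Level using (0ℓ)
open import Relation.Nullary using (¬_; yes; no)
open import Relation.Nullary.Negation using (¬¬-Monad; contradiction)
open import Relation.Binary.PropositionalEquality using (refl; subst)

open RawMonad (¬¬-Monad {a = 0ℓ}) using (_>>=_)

¬¬-least-step : ∀ {P : ℕ → Set} n → P n → ¬ P 0 → ¬ ¬ (∃[ m ] ¬ P m × P (suc m))
¬¬-least-step zero p ¬p₀ _ = ¬p₀ p
¬¬-least-step (suc n) p ¬p₀ k = k (n , (λ pₙ → ¬¬-least-step n pₙ ¬p₀ k) , p)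

¬¬-uniform-bound : ∀ {k} (P : Fin k → ℕ → Set) → (∀ i {m n} → m ≤ n → P i m → P i n) →
                   (∀ i → ¬ ¬ (∃[ n ] P i n)) → ¬ ¬ (∃[ n ] ∀ i → P i n)
¬¬-uniform-bound {zero} P mono bounds k = k (0 , λ ())
¬¬-uniform-bound {suc _} P mono bounds = do
  (n₀ , p₀) ← bounds zero
  (n₁ , p₁) ← ¬¬-uniform-bound (λ i → P (suc i)) (λ i → mono (suc i)) (λ i → bounds (suc i))
  contradiction (n₀ ⊔ n₁ , λ { zero    → mono zero (m≤m⊔n n₀ n₁) p₀
                             ; (suc i) → mono (suc i) (m≤n⊔m n₀ n₁) (p₁ i) })

module _ {V : Set} (E : V → V → Set) where

  le-suc : ∀ n {u w} → le E n u w → le E (suc n) u w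
  le-suc zero    refl x ux = x , ux , refl
  le-suc (suc n) l    x ux = let (y , wy , x≼y) = l x ux in y , wy , inj₂ x≼y

  le-mono′ : ∀ {m n u w} → m ≤′ n → le E m u w → le E n u w
  le-mono′ ≤′-refl       l = l
  le-mono′ (≤′-step m≤n) l = le-suc _ (le-mono′ m≤n l)

  le-mono : ∀ {m n u w} → m ≤ n → le E m u w → le E n u w
  le-mono m≤n = le-mono′ (≤⇒≤′ m≤n)

  atMost⇒le : ∀ n {x y} → atMost E n x y → ∃[ γ ] γ ≤ n × le E γ x y
  atMost⇒le zero    l        = 0 , z≤n , l
  atMost⇒le (suc n) (inj₁ l) = suc n , ≤-refl , l
  atMost⇒le (suc n) (inj₂ a) = let (γ , γ≤n , l) = atMost⇒le n a in γ , m≤n⇒m≤1+n γ≤n , l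

  limit-η-finite : LimitGraph E → ∀ u v → ¬ ¬ (∃[ n ] le E n u v)
  limit-η-finite (_ , (η≤ω , _) , η≢ω) u v with η≤ω v
  ... | inj₁ (n , all≤n) = contradiction (n , all≤n u)
  ... | inj₂ all≤ω       = λ ¬η<ω → η≢ω u v (all≤ω u , λ n l → ¬η<ω (n , l))

  Reach-refl : ∀ n {u} → Reach E n u u
  Reach-refl zero        = refl
  Reach-refl (suc n) {u} = u , inj₁ refl , Reach-refl n

  Reach-mono : ∀ {m n u w} → m ≤ n → Reach E m u w → Reach E n u w
  Reach-mono {n = n} z≤n       refl          = Reach-refl n
  Reach-mono         (s≤s m≤n) (x , ux , xw) = x , ux , Reach-mono m≤n xw

  Reach-snoc : ∀ n {u w x} → Reach E n u w → N[_] E w x → Reach E (suc n) u x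
  Reach-snoc zero    {x = x} refl          wx = x , wx , refl
  Reach-snoc (suc n)         (y , uy , yw) wx = y , uy , Reach-snoc n yw wx

  Reach-++ : ∀ m {n u w x} → Reach E m u w → Reach E n w x → Reach E (m + n) u x
  Reach-++ zero    refl          wx = wx
  Reach-++ (suc m) (y , uy , yw) wx = y , uy , Reach-++ m yw wx

  module _ (symE : ∀ u w → E u w → E w u) where

    Reach-sym : ∀ n {u w} → Reach E n u w → Reach E n w u
    Reach-sym zero    refl = refl
    Reach-sym (suc n) (x , inj₁ refl , xw) = Reach-snoc n (Reach-sym n xw) (inj₁ refl)
    Reach-sym (suc n) (x , inj₂ ux , xw)   = Reach-snoc n (Reach-sym n xw) (inj₂ (symE _ x ux))

    far-vertex : InfiniteDiameter E → ∀ v n → ¬ ¬ Σ V λ z → ¬ Reach E n v z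
    far-vertex diam v n k =
      let (a , b , ¬ab) = diam (n + n)
      in k (a , λ va → k (b , λ vb → ¬ab (Reach-++ n (Reach-sym n va) vb)))

  module _ (v : V) where

    -- Escape j m x: x lies outside the m-ball around v, and from x a robber can walk j steps
    -- while the ball grows by one each step (as a cop starting inside it could) and still
    -- stay outside.
    Escape : ℕ → ℕ → V → Set
    Escape zero    m x = ¬ Reach E m v x
    Escape (suc j) m x = ¬ Reach E m v x × Σ V λ q → N[_] E x q × Escape j (suc m) q

    escape-outside : ∀ j {m x} → Escape j m x → ¬ Reach E m v x
    escape-outside zero    esc           = esc
    escape-outside (suc j) (outside , _) = outside

    Escape-antitone : ∀ {i j m x} → i ≤ j → Escape j m x → Escape i m x
    Escape-antitone {j = j} z≤n       esc = escape-outside j esc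
    Escape-antitone         (s≤s i≤j) (outside , q , xq , esc) = outside , q , xq , Escape-antitone i≤j esc

    escape⇒¬le : ∀ j {n m x c} → n ≤ j → Escape j m x → Reach E m v c → ¬ le E n x c
    escape⇒¬le j {zero} _ esc vc refl = escape-outside j esc vc
    escape⇒¬le (suc j) {suc n} {m} (s≤s n≤j) (_ , q , xq , esc) vc l =
      let (y , cy , q≼y)     = l q xq
          (γ , γ≤n , q≤γy) = atMost⇒le n q≼y
      in escape⇒¬le j (≤-trans γ≤n n≤j) esc (Reach-snoc m vc cy) q≤γy

    walk⇒escape : ∀ n m {x z} → Reach E n x z → ¬ Reach E (m + n) v z → Escape n m x
    walk⇒escape zero    m {x} refl far = subst (λ t → ¬ Reach E t v x) (+-identityʳ m) far
    walk⇒escape (suc n) m {z = z} xz@(w , xw , wz) far =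
      (λ vx → far (Reach-++ m vx xz)) , w , xw ,
      walk⇒escape n (suc m) wz (subst (λ t → ¬ Reach E t v z) (+-suc m n) far)

    escaping-neighbour : Connected E → ∀ {J z} → ¬ Reach E J v z →
                         ¬ ¬ Σ V λ y → E v y × Escape J 0 y
    escaping-neighbour conn {J} {z} far = do
      let (n , vz) = conn v z
      (d , ¬vz , vz′) ← ¬¬-least-step n vz (λ v≡z → far (Reach-mono z≤n v≡z))
      first-step d ¬vz vz′
      where
      first-step : ∀ d → ¬ Reach E d v z → Reach E (suc d) v z → ¬ ¬ Σ V λ y → E v y × Escape J 0 y
      first-step d ¬vz (y , inj₁ refl , yz) = contradiction yz ¬vz
      first-step d ¬vz vz@(y , inj₂ vy , yz) with J ≤? d
      ... | yes J≤d = contradiction (y , vy , Escape-antitone J≤d (walk⇒escape d 0 yz ¬vz))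
      ... | no  J≰d = contradiction (Reach-mono (≰⇒> J≰d) vz) far

lemma1 : {V : Set} (E : V → V → Set) → IsSimple E → Connected E →
    LimitGraph E → InfiniteDiameter E → ∀ v → Infinite (Σ V (E v))
lemma1 {V} E (symE , _) conn limit diam v (k , f , surj) =
  ¬¬-uniform-bound (λ i n → le E n (neighbour i) v) (λ i → le-mono E)
                   (λ i → limit-η-finite E limit (neighbour i) v) λ (n , bounded) →
  far-vertex E symE diam v n λ (z , far) →
  escaping-neighbour E v conn far λ (y , vy , esc) →
  let (i , fi≡y) = surj (y , vy)
  in escape⇒¬le E v n ≤-refl esc refl (subst (λ w → le E n (proj₁ w) v) fi≡y (bounded i))
  where
  neighbour : Fin k → V
  neighbour i = proj₁ (f i)
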